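{- Let $n>2k\ge 6$. Let $(S,T)$ and $(S',T')$ be resistant pairs ($S,S'\subset[n]$, $T,T'\subset[2,n]$), and let $\mathcal A=\mathcal L(S,k-1)$, $\mathcal B=\mathcal L(T,k)$, $\mathcal A'=\mathcal L(S',k-1)$, $\mathcal B'=\mathcal L(T',k)$ (each pair being cross-intersecting). If $T'$ strictly precedes $T$ in $\prec$, then $|\mathcal B'|<|\mathcal B|$ and $|\mathcal A|+|\mathcal B|<|\mathcal A'|+|\mathcal B'|$.
   Context: $[a,b]=\{a,\dots,b\}$, $[i]=[1,i]$. On subsets of $[2,n]$, $A\prec B$ iff $A\supseteq B$ or the minimal element of $A\setminus B$ is smaller than the minimal element of $B\setminus A$. For $S\subset[n]$, $\mathcal L(S,a)=\{A\in\binom{[2,n]}{a}: A\prec S\cap[2,n]\}$. Sets $S\subset[n]$, $T\subset[2,n]$ form a resistant pair if either $T=\{2,3,4\}$ and $S=\{1,4\}$, or, with $j$ the largest element of $T$: (1) $S\cap T=\{j\}$, $S\cup T=[j]$, $|S|\le k$, $|T|\le k$; and (2) for each $i\ge 4$, $|[i]\cap S|<|[i]\setminus S|$. -}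

module Defs where

open import Data.Bool using (Bool; true; false; _∧_; if_then_else_)
open import Data.Nat using (ℕ; zero; suc; _≤_; _<_; _∸_; _≤ᵇ_; _≡ᵇ_)
import Data.Nat as ℕ
open import Data.Fin using (Fin; toℕ) renaming (zero to fzero; suc to fsuc)
import Data.Fin as F
open import Data.Fin.Subset
  using (Subset; inside; outside; _∈_; _⊆_; _∩_; _∪_; _─_; ∣_∣; ⁅_⁆)
open import Data.Fin.Subset.Properties using (_⊆?_)
open import Data.Vec using ([]; _∷_; tabulate)
open import Data.List using (List; _++_; map; filter; length)
open import Data.Bool.ListAction using (any)
import Data.List as L
open import Data.Maybe using (Maybe; just; nothing)
import Data.Maybe as M
open import Data.Product using (Σ; _×_; _,_)
open import Data.Sum using (_⊎_)
open import Data.Empty using (⊥)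
open import Relation.Nullary using (Dec; yes; no)
open import Relation.Nullary.Decidable using (_×-dec_; _⊎-dec_)
open import Relation.Binary.PropositionalEquality using (_≡_; _≢_)

-- Convention: a subset of [n] = {1,…,n} is a  Subset n ; the index  i : Fin n
-- stands for the natural number  toℕ i + 1.

num : ∀ {n} → Fin n → ℕ
num i = suc (toℕ i)

interval : ∀ {n} → ℕ → ℕ → Subset n
interval a b = tabulate (λ i → if (a ≤ᵇ num i) ∧ (num i ≤ᵇ b) then inside else outside)

⟪_⟫ : ∀ {n} → List ℕ → Subset n
⟪ l ⟫ = tabulate (λ i → if any (λ m → m ≡ᵇ num i) l then inside else outside)

allSubsets : (n : ℕ) → List (Subset n)
allSubsets zero = [] L.∷ L.[]
allSubsets (suc n) = map (outside ∷_) (allSubsets n) ++ map (inside ∷_) (allSubsets n)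

minElem : ∀ {n} → Subset n → Maybe (Fin n)
minElem [] = nothing
minElem (true ∷ p) = just fzero
minElem (false ∷ p) = M.map fsuc (minElem p)

MinLess : ∀ {n} → Subset n → Subset n → Set
MinLess X Y with minElem X | minElem Y
... | just a | just b = toℕ a < toℕ b
... | _ | _ = ⊥

minLess? : ∀ {n} (X Y : Subset n) → Dec (MinLess X Y)
minLess? X Y with minElem X | minElem Y
... | just a | just b = toℕ a ℕ.<? toℕ b
... | just _ | nothing = no (λ ())
... | nothing | just _ = no (λ ())
... | nothing | nothing = no (λ ())

_≺_ : ∀ {n} → Subset n → Subset n → Set
A ≺ B = (B ⊆ A) ⊎ MinLess (A ─ B) (B ─ A)

_≺?_ : ∀ {n} (A B : Subset n) → Dec (A ≺ B)
A ≺? B = (B ⊆? A) ⊎-dec minLess? (A ─ B) (B ─ A)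

InL : ∀ {n} → Subset n → ℕ → Subset n → Set
InL {n} S a A = (A ⊆ interval 2 n) × (∣ A ∣ ≡ a) × (A ≺ (S ∩ interval 2 n))

inL? : ∀ {n} (S : Subset n) (a : ℕ) (A : Subset n) → Dec (InL S a A)
inL? {n} S a A = (A ⊆? interval 2 n) ×-dec ((∣ A ∣ ℕ.≟ a) ×-dec (A ≺? (S ∩ interval 2 n)))

ℒ : ∀ {n} → Subset n → ℕ → List (Subset n)
ℒ {n} S a = filter (inL? S a) (allSubsets n)

∣ℒ∣ : ∀ {n} → Subset n → ℕ → ℕ
∣ℒ∣ S a = length (ℒ S a)

IsMax : ∀ {n} → Fin n → Subset n → Set
IsMax j T = (j ∈ T) × (∀ x → x ∈ T → toℕ x ≤ toℕ j)

Resistant : (n k : ℕ) → Subset n → Subset n → Set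
Resistant n k S T =
  ((T ≡ ⟪ 2 L.∷ 3 L.∷ 4 L.∷ L.[] ⟫) × (S ≡ ⟪ 1 L.∷ 4 L.∷ L.[] ⟫))
  ⊎ Σ (Fin n) (λ j → IsMax j T
      × ((S ∩ T ≡ ⁅ j ⁆) × (S ∪ T ≡ interval 1 (num j)) × (∣ S ∣ ≤ k) × (∣ T ∣ ≤ k))
      -- |[i] ∩ S| < |[i] \ S|  for every i ≥ 4  (|[i] \ S| = i - |[i] ∩ S|)
      × (∀ i → 4 ≤ i → ∣ S ∩ interval 1 i ∣ < i ∸ ∣ S ∩ interval 1 i ∣))

module Submission where

-- Reading a resistant pair position by position from 5 on, T and S ∩ [2,n] are complementary
-- up to their common last element j, and condition (2) forces 2, 3, 4 ∈ T. The number of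
-- a-sets preceding a set X splits over the positions outside X into binomial coefficients, so
-- |ℒ(T,k)| and |ℒ(S,k-1)| are sums of C(r,a) and C(r,b) along this walk, r being the number of
-- positions left and a, b what the counted sets still have to choose. Condition (2) keeps
-- a < b, and n > 2k keeps a + b < r, the range in which r C _ increases; comparing two walks at
-- the first position where they differ then gives both inequalities.

open import Defs
open import Data.Bool using (Bool; true; T; if_then_else_)
open import Data.Bool.Properties using (∧-zeroʳ)
open import Data.Empty using (⊥-elim)
open import Data.Fin using (Fin) renaming (zero to fzero; suc to fsuc)
open import Data.Fin.Properties using (toℕ<n)
open import Data.Fin.Subset
  using (Subset; inside; outside; ⊤; _∈_; _⊆_; _∩_; _∪_; _─_; ⁅_⁆; ∣_∣; Nonempty; Empty)
  renaming (⊥ to ∅)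
open import Data.Fin.Subset.Properties
  using (drop-∷-⊆; s⊆s; out⊆; ⊆⊤; ∉⊥; ⊥⊆; p─q⊆p; x∈p∧x∉q⇒x∈p─q; _∈?_; nonempty?; ⊆-antisym;
         p⊆p∪q; q⊆p∪q; ∩-identityʳ; ∩-zeroʳ; ∣⊥∣≡0)
open import Data.List using (List; map; filter; length; _++_)
import Data.List as List
open import Data.List.Properties using (filter-++; length-++; filter-≐; filter-none; filter-accept)
open import Data.List.Relation.Unary.All using (universal)
open import Data.Maybe using (just; nothing)
open import Data.Nat
open import Data.Nat.Combinatorics using (_C_; nCk+nC[k+1]≡[n+1]C[k+1])
open import Data.Nat.Properties
open import Data.Nat.Tactic.RingSolver using (solve-∀)
open import Data.Product using (_×_; _,_; proj₁; proj₂; ∃)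
open import Data.Sum using (inj₁; inj₂)
open import Data.Vec using ([]; _∷_; here; there; tabulate; replicate; tail)
open import Data.Vec.Properties using (tabulate-cong; ∷-injectiveʳ)
open import Function using (_∘_)
open import Level using (0ℓ)
open import Relation.Binary.PropositionalEquality
open import Relation.Nullary using (¬_; yes; no)
open import Relation.Nullary.Decidable using (_×-dec_)
open import Relation.Unary using (Pred; Decidable; _≐_)
open import Algebra.Properties.CommutativeSemigroup +-commutativeSemigroup using (xy∙z≈xz∙y)

pascal : ∀ n k → suc n C suc k ≡ n C suc k + n C k
pascal n k = trans (sym (nCk+nC[k+1]≡[n+1]C[k+1] n k)) (+-comm (n C k) (n C suc k))

C-pos : ∀ {n k} → k ≤ n → 0 < n C k
C-pos {n} {zero} _ = s≤s z≤n
C-pos {suc n} {suc k} (s≤s k≤n) rewrite pascal n k = ≤-trans (C-pos k≤n) (m≤n+m _ _)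

C-mono-≤ : ∀ {n x y} → x ≤ y → x + y ≤ n → n C x ≤ n C y
C-mono-≤ {n} {zero} _ y≤n = C-pos y≤n
C-mono-≤ {suc n} {suc x} {suc y} (s≤s x≤y) (s≤s x+1+y≤n) with m≤n⇒m<n∨m≡n x≤y
... | inj₂ refl = ≤-refl
... | inj₁ x<y rewrite pascal n x | pascal n y =
  ≤-trans (+-mono-≤ (C-mono-≤ x<y (≤-trans (≤-reflexive (sym (+-suc x y))) x+1+y≤n))
                    (C-mono-≤ (m≤n⇒m≤1+n x≤y) x+1+y≤n))
          (≤-reflexive (+-comm (n C y) (n C suc y)))

C-mono-< : ∀ {n x y} → x < y → x + y < n → n C x < n C y
C-mono-< {suc n} {zero} {suc y} _ (s≤s y<n) rewrite pascal n y =
  +-mono-≤ (C-pos y<n) (C-pos (<⇒≤ y<n))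
C-mono-< {suc n} {suc x} {suc y} (s≤s x<y) (s≤s x+1+y<n) rewrite pascal n x | pascal n y =
  <-≤-trans (+-mono-≤-< (C-mono-≤ x<y (≤-trans (≤-reflexive (sym (+-suc x y))) (<⇒≤ x+1+y<n)))
                        (C-mono-< (m≤n⇒m≤1+n x<y) x+1+y<n))
            (≤-reflexive (+-comm (n C y) (n C suc y)))

-- The order ≺ position by position

-- MinLess X Y does not determine X and Y, so the lemmas about it take them explicitly.
MinLess-outside⁻ : ∀ {n} (X Y : Subset n) → MinLess (outside ∷ X) (outside ∷ Y) → MinLess X Y
MinLess-outside⁻ X Y m with minElem X | minElem Y
... | just _  | just _  = ≤-pred m
... | just _  | nothing = m
... | nothing | _       = m

MinLess-outside⁺ : ∀ {n} (X Y : Subset n) → MinLess X Y → MinLess (outside ∷ X) (outside ∷ Y)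
MinLess-outside⁺ X Y m with minElem X | minElem Y
... | just _  | just _  = s≤s m
... | just _  | nothing = m
... | nothing | _       = m

minElem-just⇒∈ : ∀ {n} (X : Subset n) {i} → minElem X ≡ just i → i ∈ X
minElem-just⇒∈ (inside ∷ X) refl = here
minElem-just⇒∈ (outside ∷ X) eq with minElem X in eqX
minElem-just⇒∈ (outside ∷ X) refl | just _ = there (minElem-just⇒∈ X eqX)

minElem-nothing⇒Empty : ∀ {n} (X : Subset n) → minElem X ≡ nothing → Empty X
minElem-nothing⇒Empty (outside ∷ X) eq (fsuc i , there i∈X) with minElem X in eqX
... | nothing = minElem-nothing⇒Empty X eqX (i , i∈X)

MinLess⇒Nonempty : ∀ {n} (X Y : Subset n) → MinLess X Y → Nonempty X
MinLess⇒Nonempty X Y m with minElem X in eqX | minElem Y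
... | just i | just _ = i , minElem-just⇒∈ X eqX

≺-∷⁻ : ∀ {n} x {A B : Subset n} → (x ∷ A) ≺ (x ∷ B) → A ≺ B
≺-∷⁻ _               (inj₁ B⊆A) = inj₁ (drop-∷-⊆ B⊆A)
≺-∷⁻ outside {A} {B} (inj₂ m)   = inj₂ (MinLess-outside⁻ (A ─ B) (B ─ A) m)
≺-∷⁻ inside  {A} {B} (inj₂ m)   = inj₂ (MinLess-outside⁻ (A ─ B) (B ─ A) m)

≺-∷⁺ : ∀ {n} x {A B : Subset n} → A ≺ B → (x ∷ A) ≺ (x ∷ B)
≺-∷⁺ _               (inj₁ B⊆A) = inj₁ (s⊆s B⊆A)
≺-∷⁺ outside {A} {B} (inj₂ m)   = inj₂ (MinLess-outside⁺ (A ─ B) (B ─ A) m)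
≺-∷⁺ inside  {A} {B} (inj₂ m)   = inj₂ (MinLess-outside⁺ (A ─ B) (B ─ A) m)

¬MinLess-outside-inside : ∀ {n} (X Y : Subset n) → ¬ MinLess (outside ∷ X) (inside ∷ Y)
¬MinLess-outside-inside X Y m with minElem X
... | just _  = n≮0 m
... | nothing = m

outside⊀inside : ∀ {n} {A B : Subset n} → ¬ (outside ∷ A) ≺ (inside ∷ B)
outside⊀inside (inj₁ B⊆A) with B⊆A here
... | ()
outside⊀inside {A = A} {B} (inj₂ m) = ¬MinLess-outside-inside (A ─ B) (B ─ A) m

MinLess-inside-outside : ∀ {n} (X Y : Subset n) → Nonempty Y → MinLess (inside ∷ X) (outside ∷ Y)
MinLess-inside-outside X Y ne with minElem Y in eq
... | just _  = z<s
... | nothing = ⊥-elim (minElem-nothing⇒Empty Y eq ne)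

─-Empty⇒⊆ : ∀ {n} {A B : Subset n} → Empty (B ─ A) → B ⊆ A
─-Empty⇒⊆ {A = A} e {x} x∈B with x ∈? A
... | yes x∈A = x∈A
... | no  x∉A = ⊥-elim (e (x , x∈p∧x∉q⇒x∈p─q x∈B x∉A))

inside≺outside : ∀ {n} {A B : Subset n} → (inside ∷ A) ≺ (outside ∷ B)
inside≺outside {A = A} {B} with nonempty? (B ─ A)
... | yes ne = inj₂ (MinLess-inside-outside (A ─ B) (B ─ A) ne)
... | no  e  = inj₁ (out⊆ (─-Empty⇒⊆ e))

∅⊀ : ∀ {n} {B : Subset n} → Nonempty B → ¬ (∅ ≺ B)
∅⊀ (_ , x∈B) (inj₁ B⊆∅) = ∉⊥ (B⊆∅ x∈B)
∅⊀ {B = B} _ (inj₂ m) = ∉⊥ (p─q⊆p ∅ B (proj₂ (MinLess⇒Nonempty (∅ ─ B) (B ─ ∅) m)))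

-- Counting the sets preceding a set

#subsets : ∀ {m} {P : Pred (Subset m) 0ℓ} → Decidable P → ℕ
#subsets {m} P? = length (filter P? (allSubsets m))

length-filter-map : ∀ {A B : Set} {P : Pred B 0ℓ} (P? : Decidable P) (f : A → B) (xs : List A) →
                    length (filter P? (map f xs)) ≡ length (filter (P? ∘ f) xs)
length-filter-map P? f List.[] = refl
length-filter-map P? f (x List.∷ xs) with P? (f x)
... | yes _ = cong suc (length-filter-map P? f xs)
... | no  _ = length-filter-map P? f xs

#subsets-∷ : ∀ {m} {P : Pred (Subset (suc m)) 0ℓ} (P? : Decidable P) →
             #subsets P? ≡ #subsets (P? ∘ (outside ∷_)) + #subsets (P? ∘ (inside ∷_))
#subsets-∷ {m} P? = begin
  length (filter P? (map (outside ∷_) xs ++ map (inside ∷_) xs))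
    ≡⟨ cong length (filter-++ P? (map (outside ∷_) xs) (map (inside ∷_) xs)) ⟩
  length (filter P? (map (outside ∷_) xs) ++ filter P? (map (inside ∷_) xs))
    ≡⟨ length-++ (filter P? (map (outside ∷_) xs)) ⟩
  length (filter P? (map (outside ∷_) xs)) + length (filter P? (map (inside ∷_) xs))
    ≡⟨ cong₂ _+_ (length-filter-map P? (outside ∷_) xs) (length-filter-map P? (inside ∷_) xs) ⟩
  #subsets (P? ∘ (outside ∷_)) + #subsets (P? ∘ (inside ∷_)) ∎
  where
  open ≡-Reasoning
  xs = allSubsets m

#subsets-cong : ∀ {m} {P Q : Pred (Subset m) 0ℓ} (P? : Decidable P) (Q? : Decidable Q) →
                P ≐ Q → #subsets P? ≡ #subsets Q?
#subsets-cong {m} P? Q? P≐Q = cong length (filter-≐ P? Q? P≐Q (allSubsets m))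

#subsets-none : ∀ {m} {P : Pred (Subset m) 0ℓ} (P? : Decidable P) → (∀ A → ¬ P A) → #subsets P? ≡ 0
#subsets-none {m} P? ¬P = cong length (filter-none P? (universal ¬P (allSubsets m)))

size? : ∀ {m} (a : ℕ) → Decidable (λ (A : Subset m) → ∣ A ∣ ≡ a)
size? a A = ∣ A ∣ ≟ a

#subsets-size : ∀ m a → #subsets (size? {m} a) ≡ m C a
#subsets-size zero    zero    = refl
#subsets-size zero    (suc a) = refl
#subsets-size (suc m) a = trans (#subsets-∷ (size? {suc m} a)) (by-head a)
  where
  by-head : ∀ a → #subsets (size? {suc m} a ∘ (outside ∷_)) + #subsets (size? {suc m} a ∘ (inside ∷_))
                  ≡ suc m C a
  by-head zero    =
    cong₂ _+_ (#subsets-size m zero) (#subsets-none (size? {suc m} zero ∘ (inside ∷_)) (λ _ ()))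
  by-head (suc a) = begin
    #subsets (size? {suc m} (suc a) ∘ (outside ∷_)) + #subsets (size? {suc m} (suc a) ∘ (inside ∷_))
      ≡⟨ cong₂ _+_ (#subsets-size m (suc a))
                   (trans (#subsets-cong (size? {suc m} (suc a) ∘ (inside ∷_)) (size? a)
                                         (suc-injective , cong suc))
                          (#subsets-size m a)) ⟩
    m C suc a + m C a
      ≡⟨ pascal m a ⟨
    suc m C suc a ∎
    where open ≡-Reasoning

-- #≺ a B is the number of a-sets A ≺ B, computed at the first position: where B has it, A must
-- have it too; where B lacks it, A either lacks it as well or has it, and then any rest will do.
#≺ : ∀ {r} → ℕ → Subset r → ℕ
#≺ zero    []            = 1
#≺ (suc a) []            = 0
#≺ zero    (inside ∷ B)  = 0
#≺ (suc a) (inside ∷ B)  = #≺ a B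
#≺ zero    (outside ∷ B) = #≺ zero B
#≺ {suc r} (suc a) (outside ∷ B) = #≺ (suc a) B + r C a

#≺-∅ : ∀ r a → #≺ a (∅ {r}) ≡ r C a
#≺-∅ zero    zero    = refl
#≺-∅ zero    (suc a) = refl
#≺-∅ (suc r) zero    = #≺-∅ r zero
#≺-∅ (suc r) (suc a) = trans (cong (_+ r C a) (#≺-∅ r (suc a))) (sym (pascal r a))

below? : ∀ {m} (a : ℕ) (B : Subset m) → Decidable (λ A → (∣ A ∣ ≡ a) × (A ≺ B))
below? a B A = (∣ A ∣ ≟ a) ×-dec (A ≺? B)

#subsets-below : ∀ m a (B : Subset m) → #subsets (below? a B) ≡ #≺ a B
#subsets-below zero zero    [] =
  cong length (filter-accept (below? zero []) {xs = List.[]} (refl , inj₁ (λ p → p)))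
#subsets-below zero (suc a) [] = #subsets-none (below? (suc a) []) (λ { [] (() , _) })
#subsets-below (suc m) a (b ∷ B) = trans (#subsets-∷ (below? a (b ∷ B))) (by-head a b)
  where
  outside-outside : ∀ a → #subsets (below? a (outside ∷ B) ∘ (outside ∷_)) ≡ #≺ a B
  outside-outside a =
    trans (#subsets-cong (below? a (outside ∷ B) ∘ (outside ∷_)) (below? a B)
             ((λ (e , p) → e , ≺-∷⁻ outside p) , (λ (e , p) → e , ≺-∷⁺ outside p)))
          (#subsets-below m a B)
  inside-inside : ∀ a → #subsets (below? (suc a) (inside ∷ B) ∘ (inside ∷_)) ≡ #≺ a B
  inside-inside a =
    trans (#subsets-cong (below? (suc a) (inside ∷ B) ∘ (inside ∷_)) (below? a B)
             ((λ (e , p) → suc-injective e , ≺-∷⁻ inside p) , (λ (e , p) → cong suc e , ≺-∷⁺ inside p)))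
          (#subsets-below m a B)
  outside-first : ∀ a → #subsets (below? a (inside ∷ B) ∘ (outside ∷_)) ≡ 0
  outside-first a = #subsets-none (below? a (inside ∷ B) ∘ (outside ∷_)) (λ _ (_ , p) → outside⊀inside p)
  by-head : ∀ a b → #subsets (below? a (b ∷ B) ∘ (outside ∷_)) + #subsets (below? a (b ∷ B) ∘ (inside ∷_))
                  ≡ #≺ a (b ∷ B)
  by-head zero outside = trans (cong₂ _+_ (outside-outside zero)
                               (#subsets-none (below? zero (outside ∷ B) ∘ (inside ∷_)) (λ { _ (() , _) })))
                             (+-identityʳ _)
  by-head (suc a) outside = cong₂ _+_ (outside-outside (suc a))
    (trans (#subsets-cong (below? (suc a) (outside ∷ B) ∘ (inside ∷_)) (size? a)
              ((λ (e , _) → suc-injective e) , (λ e → cong suc e , inside≺outside)))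
           (#subsets-size m a))
  by-head zero inside = cong₂ _+_ (outside-first zero)
                        (#subsets-none (below? zero (inside ∷ B) ∘ (inside ∷_)) (λ { _ (() , _) }))
  by-head (suc a) inside = cong₂ _+_ (outside-first (suc a)) (inside-inside a)

tabulate-const : ∀ m (x : Bool) → tabulate {n = m} (λ _ → x) ≡ replicate m x
tabulate-const zero    x = refl
tabulate-const (suc m) x = cong (x ∷_) (tabulate-const m x)

interval-2 : ∀ m → interval 2 (suc m) ≡ outside ∷ ⊤
interval-2 m = cong (outside ∷_) (trans (tabulate-cong (λ i → if-T (≤⇒≤ᵇ (s≤s (toℕ<n i)))))
                                        (tabulate-const m inside))
  where
  if-T : ∀ {b} → T b → (if b then inside else outside) ≡ inside
  if-T {true} _ = refl

∩-interval-2 : ∀ {m} (X : Subset (suc m)) → X ∩ interval 2 (suc m) ≡ outside ∷ tail X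
∩-interval-2 {m} (x ∷ X) =
  trans (cong ((x ∷ X) ∩_) (interval-2 m)) (cong₂ _∷_ (∧-zeroʳ x) (∩-identityʳ X))

∣ℒ∣≡#≺-tail : ∀ {m} (X : Subset (suc m)) a → ∣ℒ∣ X a ≡ #≺ a (tail X)
∣ℒ∣≡#≺-tail {m} X a = begin
  ∣ℒ∣ X a
    ≡⟨ #subsets-∷ (inL? X a) ⟩
  #subsets (inL? X a ∘ (outside ∷_)) + #subsets (inL? X a ∘ (inside ∷_))
    ≡⟨ cong₂ _+_ (#subsets-cong (inL? X a ∘ (outside ∷_)) (below? a (tail X)) (to , from))
                 (#subsets-none (inL? X a ∘ (inside ∷_)) (λ _ (A⊆ , _) → inside⊈interval-2 A⊆)) ⟩
  #subsets (below? a (tail X)) + 0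
    ≡⟨ cong (_+ 0) (#subsets-below m a (tail X)) ⟩
  #≺ a (tail X) + 0
    ≡⟨ +-identityʳ _ ⟩
  #≺ a (tail X) ∎
  where
  open ≡-Reasoning
  inside⊈interval-2 : ∀ {A : Subset m} → ¬ (inside ∷ A) ⊆ interval 2 (suc m)
  inside⊈interval-2 A⊆ with subst (fzero ∈_) (interval-2 m) (A⊆ here)
  ... | ()
  to : ∀ {A} → InL X a (outside ∷ A) → (∣ A ∣ ≡ a) × (A ≺ tail X)
  to (_ , e , p) = e , ≺-∷⁻ outside (subst (_ ≺_) (∩-interval-2 X) p)
  from : ∀ {A} → (∣ A ∣ ≡ a) × (A ≺ tail X) → InL X a (outside ∷ A)
  from {A} (e , p) = subst ((outside ∷ A) ⊆_) (sym (interval-2 m)) (out⊆ ⊆⊤) , e ,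
                 subst (_ ≺_) (sym (∩-interval-2 X)) (≺-∷⁺ outside p)

-- t and s are T and S ∩ [2,n] on the last r positions; a and b are the numbers of elements the
-- sets counted in ℒ(T,k) and ℒ(S,k-1) still have to choose there once they agree with T and S
-- on the earlier positions, and r = a + b + c. Each position lies in exactly one of t and s,
-- except the last one, which lies in both.
data Walk (c : ℕ) : ℕ → ℕ → (r : ℕ) → Subset r → Subset r → Set where
  stop  : ∀ {r a b} → suc r ≡ suc a + suc b + c → suc a < b →
          Walk c (suc a) (suc b) (suc r) (inside ∷ ∅) (inside ∷ ∅)
  stepS : ∀ {r a b t s} → suc r ≡ suc a + suc b + c → Walk c (suc a) b r t s →
          Walk c (suc a) (suc b) (suc r) (outside ∷ t) (inside ∷ s)
  stepT : ∀ {r a b t s} → suc r ≡ suc (suc a) + b + c → suc (suc a) < b → Walk c (suc a) b r t s →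
          Walk c (suc (suc a)) b (suc r) (inside ∷ t) (outside ∷ s)

walk-< : ∀ {c a b r t s} → Walk c a b r t s → a < b
walk-< (stop _ a+1<b)    = s≤s (<⇒≤ a+1<b)
walk-< (stepS _ w)       = m<n⇒m<1+n (walk-< w)
walk-< (stepT _ a+2<b _) = a+2<b

walk-nonempty : ∀ {c a b r t s} → Walk c a b r t s → Nonempty t
walk-nonempty (stop _ _)      = fzero , here
walk-nonempty (stepS _ w)     = let (i , i∈t) = walk-nonempty w in fsuc i , there i∈t
walk-nonempty (stepT _ _ _)   = fzero , here

m≡n+1+o⇒n<m : ∀ {x c r} → r ≡ x + suc c → x < r
m≡n+1+o⇒n<m {x} eq = ≤-trans (m<m+n x z<s) (≤-reflexive (sym eq))

#≺-walk-t : ∀ {c a b r t s} → Walk c a b r t s → 0 < #≺ a t × #≺ a t < r C a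
#≺-walk-t (stop {r} {a} {b} eq _) rewrite #≺-∅ r a | pascal r a =
  C-pos (<⇒≤ a<r) , m<n+m (r C a) (C-pos a<r)
  where
  a<r : a < r
  a<r = subst (a <_) (sym (suc-injective eq)) (≤-trans (m<m+n a z<s) (m≤m+n (a + suc b) _))
#≺-walk-t (stepS {r} {a} _ w) rewrite pascal r a =
  let (pos , lt) = #≺-walk-t w in <-≤-trans pos (m≤m+n _ _) , +-monoˡ-< (r C a) lt
#≺-walk-t (stepT {r} {a} _ _ w) rewrite pascal r (suc a) =
  let (pos , lt) = #≺-walk-t w in pos , <-≤-trans lt (m≤n+m _ _)

#≺-walk-sum : ∀ {c a b r t s} → Walk (suc c) a b r t s →
          r C a < #≺ a t + #≺ b s × #≺ a t + #≺ b s < r C b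
#≺-walk-sum (stop {r} {a} {b} eq a+1<b) rewrite #≺-∅ r a | #≺-∅ r b =
  (begin-strict
     suc r C suc a      ≡⟨ pascal r a ⟩
     r C suc a + r C a  <⟨ +-monoˡ-< (r C a) (C-mono-< a+1<b (subst (_< r) (+-suc a b) a+b+1<r)) ⟩
     r C b + r C a      ≡⟨ +-comm (r C b) (r C a) ⟩
     r C a + r C b      ∎) ,
  (begin-strict
     r C a + r C b      <⟨ +-monoˡ-< (r C b) (C-mono-< (m<n⇒m<1+n (<-trans (n<1+n a) a+1<b)) a+b+1<r) ⟩
     r C suc b + r C b  ≡⟨ pascal r b ⟨
     suc r C suc b      ∎)
  where
  open ≤-Reasoning
  a+b+1<r : a + suc b < r
  a+b+1<r = m≡n+1+o⇒n<m (suc-injective eq)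
#≺-walk-sum (stepS {r} {a} {b} {t} {s} eq w) =
  (begin-strict
     suc r C suc a                 ≡⟨ pascal r a ⟩
     r C suc a + r C a             <⟨ +-monoˡ-< (r C a) lower ⟩
     (X + Y) + r C a               ≡⟨ xy∙z≈xz∙y X Y (r C a) ⟩
     (X + r C a) + Y               ∎) ,
  (begin-strict
     (X + r C a) + Y               ≡⟨ xy∙z≈xz∙y X Y (r C a) ⟨
     (X + Y) + r C a               <⟨ +-mono-<-≤ upper (C-mono-≤ a≤b+1 a+b+1≤r) ⟩
     r C b + r C suc b             ≡⟨ +-comm (r C b) (r C suc b) ⟩
     r C suc b + r C b             ≡⟨ pascal r b ⟨
     suc r C suc b                 ∎)
  where
  open ≤-Reasoning
  X Y : ℕ
  X = #≺ (suc a) t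
  Y = #≺ b s
  lower : r C suc a < X + Y
  lower = proj₁ (#≺-walk-sum w)
  upper : X + Y < r C b
  upper = proj₂ (#≺-walk-sum w)
  a≤b+1 : a ≤ suc b
  a≤b+1 = ≤-trans (n≤1+n a) (≤-trans (<⇒≤ (walk-< w)) (n≤1+n b))
  a+b+1≤r : a + suc b ≤ r
  a+b+1≤r = <⇒≤ (m≡n+1+o⇒n<m (suc-injective eq))
#≺-walk-sum (stepT {r} {a} {suc b} {t} {s} eq a+2<b w) =
  (begin-strict
     suc r C suc (suc a)           ≡⟨ pascal r (suc a) ⟩
     r C suc (suc a) + r C suc a   ≡⟨ +-comm (r C suc (suc a)) (r C suc a) ⟩
     r C suc a + r C suc (suc a)   <⟨ +-mono-<-≤ lower (C-mono-≤ (≤-pred a+2<b) a+2+b≤r) ⟩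
     (X + Y) + r C b               ≡⟨ +-assoc X Y (r C b) ⟩
     X + (Y + r C b)               ∎) ,
  (begin-strict
     X + (Y + r C b)               ≡⟨ +-assoc X Y (r C b) ⟨
     (X + Y) + r C b               <⟨ +-monoˡ-< (r C b) upper ⟩
     r C suc b + r C b             ≡⟨ pascal r b ⟨
     suc r C suc b                 ∎)
  where
  open ≤-Reasoning
  X Y : ℕ
  X = #≺ (suc a) t
  Y = #≺ (suc b) s
  lower : r C suc a < X + Y
  lower = proj₁ (#≺-walk-sum w)
  upper : X + Y < r C suc b
  upper = proj₂ (#≺-walk-sum w)
  a+2+b≤r : suc (suc a) + b ≤ r
  a+2+b≤r = subst (_≤ r) (+-suc (suc a) b) (<⇒≤ (m≡n+1+o⇒n<m (suc-injective eq)))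

#≺-walk-compare : ∀ {c a b r t s t′ s′} → Walk (suc c) a b r t s → Walk (suc c) a b r t′ s′ →
                  t′ ≺ t → t′ ≢ t →
             #≺ a t′ < #≺ a t × #≺ a t + #≺ b s < #≺ a t′ + #≺ b s′
#≺-walk-compare (stop _ _) (stop _ _) _ t′≢t = ⊥-elim (t′≢t refl)
#≺-walk-compare (stepS {r} {a} {b} {t} {s} _ w) (stepS {t = t′} {s = s′} _ w′) t′≺t t′≢t =
  let (fewer , more) = #≺-walk-compare w w′ (≺-∷⁻ outside t′≺t) (t′≢t ∘ cong (outside ∷_)) in
  +-monoˡ-< (r C a) fewer ,
  subst₂ _<_ (xy∙z≈xz∙y (#≺ (suc a) t) (#≺ b s) (r C a)) (xy∙z≈xz∙y (#≺ (suc a) t′) (#≺ b s′) (r C a))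
    (+-monoˡ-< (r C a) more)
#≺-walk-compare (stepT {r} {a} {suc b} {t} {s} _ _ w) (stepT {t = t′} {s = s′} _ _ w′) t′≺t t′≢t =
  let (fewer , more) = #≺-walk-compare w w′ (≺-∷⁻ inside t′≺t) (t′≢t ∘ cong (inside ∷_)) in
  fewer ,
  subst₂ _<_ (+-assoc (#≺ (suc a) t) (#≺ (suc b) s) (r C b))
             (+-assoc (#≺ (suc a) t′) (#≺ (suc b) s′) (r C b))
    (+-monoˡ-< (r C b) more)
#≺-walk-compare (stepS {r} {suc a} {b} {t} {s} _ w) (stepT {t = t′} {s = s′} _ _ w′) _ _ =
  <-≤-trans (proj₂ (#≺-walk-t w′)) (m≤n+m _ _) ,
  (begin-strict
     (#≺ (suc (suc a)) t + r C suc a) + #≺ b s   ≡⟨ xy∙z≈xz∙y (#≺ (suc (suc a)) t) (#≺ b s) (r C suc a) ⟨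
     (#≺ (suc (suc a)) t + #≺ b s) + r C suc a   <⟨ +-monoˡ-< (r C suc a) (proj₂ (#≺-walk-sum w)) ⟩
     r C b + r C suc a                           ≡⟨ +-comm (r C b) (r C suc a) ⟩
     r C suc a + r C b                           <⟨ +-monoˡ-< (r C b) (proj₁ (#≺-walk-sum w′)) ⟩
     (#≺ (suc a) t′ + #≺ (suc b) s′) + r C b     ≡⟨ +-assoc (#≺ (suc a) t′) _ (r C b) ⟩
     #≺ (suc a) t′ + (#≺ (suc b) s′ + r C b)     ∎)
  where open ≤-Reasoning
#≺-walk-compare (stepS {r} {a} {b} {t} {s} _ w) (stop _ _) _ _ rewrite #≺-∅ r a | #≺-∅ r b =
  +-monoˡ-≤ (r C a) (proj₁ (#≺-walk-t w)) ,
  (begin-strict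
     (#≺ (suc a) t + r C a) + #≺ b s   ≡⟨ xy∙z≈xz∙y (#≺ (suc a) t) (#≺ b s) (r C a) ⟨
     (#≺ (suc a) t + #≺ b s) + r C a   <⟨ +-monoˡ-< (r C a) (proj₂ (#≺-walk-sum w)) ⟩
     r C b + r C a                     ≡⟨ +-comm (r C b) (r C a) ⟩
     r C a + r C b                     ∎)
  where open ≤-Reasoning
#≺-walk-compare (stop {r} {suc a} {b} _ _) (stepT {t = t′} {s = s′} _ _ w′) _ _
  rewrite #≺-∅ r (suc a) | #≺-∅ r b =
  proj₂ (#≺-walk-t w′) ,
  (begin-strict
     r C suc a + r C b                         <⟨ +-monoˡ-< (r C b) (proj₁ (#≺-walk-sum w′)) ⟩
     (#≺ (suc a) t′ + #≺ (suc b) s′) + r C b   ≡⟨ +-assoc (#≺ (suc a) t′) _ (r C b) ⟩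
     #≺ (suc a) t′ + (#≺ (suc b) s′ + r C b)   ∎)
  where open ≤-Reasoning
#≺-walk-compare (stepT _ _ _) (stepS _ _) t′≺t _ = ⊥-elim (outside⊀inside t′≺t)
#≺-walk-compare (stop _ _)    (stepS _ _) t′≺t _ = ⊥-elim (outside⊀inside t′≺t)
#≺-walk-compare (stepT _ _ w) (stop _ _)  t′≺t _ = ⊥-elim (∅⊀ (walk-nonempty w) (≺-∷⁻ inside t′≺t))

-- Resistant pairs are walks

data Split : ∀ {r} → Subset r → Subset r → Set where
  last : ∀ {r} → Split {suc r} (inside ∷ ∅) (inside ∷ ∅)
  toS  : ∀ {r} {t s : Subset r} → Split t s → Split (outside ∷ t) (inside ∷ s)
  toT  : ∀ {r} {t s : Subset r} → Split t s → Split (inside ∷ t) (outside ∷ s)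

interval-1-0 : ∀ r → interval {r} 1 0 ≡ ∅
interval-1-0 zero    = refl
interval-1-0 (suc r) = cong (outside ∷_) (interval-1-0 r)

∪≡∅ : ∀ {r} {s t : Subset r} → s ∪ t ≡ ∅ → s ≡ ∅ × t ≡ ∅
∪≡∅ {s = s} {t} eq = ⊆-antisym (subst (s ⊆_) eq (p⊆p∪q t)) ⊥⊆ ,
                     ⊆-antisym (subst (t ⊆_) eq (q⊆p∪q s t)) ⊥⊆

split : ∀ {r} (s t : Subset r) (j : Fin r) → s ∩ t ≡ ⁅ j ⁆ → s ∪ t ≡ interval 1 (num j) → Split t s
split (inside ∷ s) (inside ∷ t) fzero _ eq∪ with ∪≡∅ (trans (∷-injectiveʳ eq∪) (interval-1-0 _))
... | refl , refl = last
split (outside ∷ s) (inside ∷ t) (fsuc j) eq∩ eq∪ = toT (split s t j (∷-injectiveʳ eq∩) (∷-injectiveʳ eq∪))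
split (inside ∷ s) (outside ∷ t) (fsuc j) eq∩ eq∪ = toS (split s t j (∷-injectiveʳ eq∩) (∷-injectiveʳ eq∪))
split (outside ∷ s) (outside ∷ t) (fsuc j) _ ()
split (inside ∷ s) (inside ∷ t) (fsuc j) () _
split (outside ∷ s) (_ ∷ t) fzero () _
split (inside ∷ s) (outside ∷ t) fzero () _

split-nonempty : ∀ {r} {t s : Subset r} → Split t s → 0 < ∣ t ∣
split-nonempty last      = z<s
split-nonempty (toS sp)  = split-nonempty sp
split-nonempty (toT _)   = z<s

-- Condition (2) of a resistant pair read from some position of [2,n] on: v is the rest of
-- S ∩ [2,n], p the number of earlier positions of [2,n] and σ the number of those in S
-- (the suc accounts for 1 ∈ S).
record Sparse {r} (p σ : ℕ) (v : Subset r) : Set where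
  constructor sparse
  field
    bound : ∀ q → 3 ≤ p + q → suc ((σ + ∣ v ∩ interval 1 q ∣) + (σ + ∣ v ∩ interval 1 q ∣)) < p + q

sparse-outside : ∀ {r p σ} {v : Subset r} → Sparse p σ (outside ∷ v) → Sparse (suc p) σ v
sparse-outside {p = p} {σ} {v} (sparse D) = sparse λ q 3≤p+q →
  subst (suc ((σ + ∣ v ∩ interval 1 q ∣) + (σ + ∣ v ∩ interval 1 q ∣)) <_) (+-suc p q)
        (D (suc q) (subst (3 ≤_) (sym (+-suc p q)) 3≤p+q))

sparse-inside : ∀ {r p σ} {v : Subset r} → Sparse p σ (inside ∷ v) → Sparse (suc p) (suc σ) v
sparse-inside {p = p} {σ} {v} (sparse D) = sparse λ q 3≤p+q →
  subst₂ (λ x y → suc (x + x) < y) (+-suc σ (∣ v ∩ interval 1 q ∣)) (+-suc p q)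
         (D (suc q) (subst (3 ≤_) (sym (+-suc p q)) 3≤p+q))

∣∩interval-1-0∣ : ∀ {r} (v : Subset r) → ∣ v ∩ interval 1 0 ∣ ≡ 0
∣∩interval-1-0∣ {r} v rewrite interval-1-0 r | ∩-zeroʳ v = ∣⊥∣≡0 r

sparse-here : ∀ {r τ σ} {v : Subset r} → Sparse (τ + σ) σ v → 3 ≤ τ → 2 + σ ≤ τ
sparse-here {τ = τ} {σ} {v} (sparse D) 3≤τ =
  +-cancelʳ-≤ σ (2 + σ) τ (subst₂ (λ x y → suc (x + x) < y) σ+0≡σ (+-identityʳ (τ + σ)) (D 0 3≤τ+σ+0))
  where
  σ+0≡σ : σ + ∣ v ∩ interval 1 0 ∣ ≡ σ
  σ+0≡σ = trans (cong (σ +_) (∣∩interval-1-0∣ v)) (+-identityʳ σ)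
  3≤τ+σ+0 : 3 ≤ τ + σ + 0
  3≤τ+σ+0 = subst (3 ≤_) (sym (+-identityʳ (τ + σ))) (≤-trans 3≤τ (m≤m+n τ σ))

sparse-last : ∀ {r τ σ} {v : Subset r} → Sparse (τ + σ) σ (inside ∷ v) → 3 ≤ τ → 3 + σ ≤ τ
sparse-last {τ = τ} {σ} {v} (sparse D) 3≤τ =
  +-cancelʳ-≤ (suc σ) (3 + σ) τ (subst₂ (λ x y → suc (x + x) < y) σ+1≡1+σ τ+σ+1≡τ+1+σ (D 1 3≤τ+σ+1))
  where
  σ+1≡1+σ : σ + suc ∣ v ∩ interval 1 0 ∣ ≡ suc σ
  σ+1≡1+σ = trans (cong (λ x → σ + suc x) (∣∩interval-1-0∣ v)) (+-comm σ 1)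
  τ+σ+1≡τ+1+σ : τ + σ + 1 ≡ τ + suc σ
  τ+σ+1≡τ+1+σ = trans (+-assoc τ σ 1) (cong (τ +_) (+-comm σ 1))
  3≤τ+σ+1 : 3 ≤ τ + σ + 1
  3≤τ+σ+1 = ≤-trans 3≤τ (≤-trans (m≤m+n τ σ) (m≤m+n (τ + σ) 1))

balance⇒≤ : ∀ {a b τ σ d} → a + τ ≡ b + σ → d + σ ≤ τ → d + a ≤ b
balance⇒≤ {a} {b} {τ} {σ} {d} eq d+σ≤τ = +-cancelʳ-≤ σ (d + a) b (begin
  (d + a) + σ   ≡⟨ xy∙z≈xz∙y d a σ ⟩
  (d + σ) + a   ≡⟨ +-comm (d + σ) a ⟩
  a + (d + σ)   ≤⟨ +-monoʳ-≤ a d+σ≤τ ⟩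
  a + τ         ≡⟨ eq ⟩
  b + σ         ∎)
  where open ≤-Reasoning

-- τ and σ are the numbers of earlier positions of [2,n] in T and in S, so a + τ = k = 1 + b + σ.
split⇒walk : ∀ {c r a b τ σ} {t s : Subset r} → Split t s →
             r ≡ a + b + c → a + τ ≡ suc b + σ → 3 ≤ τ → ∣ t ∣ ≤ a → ∣ s ∣ ≤ b → Sparse (τ + σ) σ s →
             Walk c a b r t s
split⇒walk {a = zero}  last _ _ _ () _ _
split⇒walk {b = zero}  last _ _ _ _ () _
split⇒walk {r = suc r} {suc a} {suc b} {τ} {σ} last r≡ a+τ≡ 3≤τ _ _ D =
  stop r≡ (s≤s⁻¹ (balance⇒≤ (suc-injective a+τ≡) (sparse-last D 3≤τ)))
split⇒walk {b = zero} (toS _) _ _ _ _ () _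
split⇒walk {a = zero} (toS sp) _ _ _ t≤0 _ _ = ⊥-elim (n≮n 0 (<-≤-trans (split-nonempty sp) t≤0))
split⇒walk {c} {a = suc a} {suc b} {τ} {σ} {s = inside ∷ s} (toS sp) r≡ a+τ≡ 3≤τ t≤a s≤b D =
  stepS r≡ (split⇒walk sp (trans (suc-injective r≡) (cong (_+ c) (+-suc a b)))
                          (trans a+τ≡ (sym (+-suc (suc b) σ))) 3≤τ t≤a (s≤s⁻¹ s≤b)
                          (subst (λ p → Sparse p (suc σ) s) (sym (+-suc τ σ)) (sparse-inside D)))
split⇒walk {a = zero} (toT _) _ _ _ () _ _
split⇒walk {a = suc zero} (toT sp) _ _ _ t≤1 _ _ =
  ⊥-elim (n≮n 0 (<-≤-trans (split-nonempty sp) (s≤s⁻¹ t≤1)))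
split⇒walk {a = suc (suc a)} {τ = τ} {σ} {s = outside ∷ s} (toT sp) r≡ a+τ≡ 3≤τ t≤a s≤b D =
  stepT r≡ (balance⇒≤ (suc-injective a+τ≡) (sparse-here D 3≤τ))
           (split⇒walk sp (suc-injective r≡) (trans (+-suc (suc a) τ) a+τ≡) (≤-trans 3≤τ (n≤1+n τ))
                       (s≤s⁻¹ t≤a) s≤b (sparse-outside D))

<∸⇒+< : ∀ o {x n} → x < n ∸ o → o + x < n
<∸⇒+< zero                x<n   = x<n
<∸⇒+< (suc o) {n = suc n} x<n∸o = s≤s (<∸⇒+< o x<n∸o)

sparse-start : ∀ {r} (s : Subset r) →
               (∀ i → 4 ≤ i → ∣ (inside ∷ s) ∩ interval 1 i ∣ < i ∸ ∣ (inside ∷ s) ∩ interval 1 i ∣) →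
               Sparse 0 0 s
sparse-start s dense = sparse λ q 3≤q →
  subst (_< q) (+-suc (∣ s ∩ interval 1 q ∣) _) (<∸⇒+< (∣ s ∩ interval 1 q ∣) (dense (suc q) (s≤s 3≤q)))

1+2[1+w]≮3 : ∀ w → ¬ suc (suc w + suc w) < 3
1+2[1+w]≮3 zero    (s≤s (s≤s (s≤s ())))
1+2[1+w]≮3 (suc w) (s≤s (s≤s (s≤s ())))

sparse-prefix : ∀ {r x y z} {s : Subset r} → Sparse 0 0 (x ∷ y ∷ z ∷ s) →
                x ≡ outside × y ≡ outside × z ≡ outside
sparse-prefix {x = outside} {outside} {outside} _ = refl , refl , refl
sparse-prefix {x = inside}                      (sparse D) = ⊥-elim (1+2[1+w]≮3 _ (D 3 ≤-refl))
sparse-prefix {x = outside} {inside}            (sparse D) = ⊥-elim (1+2[1+w]≮3 _ (D 3 ≤-refl))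
sparse-prefix {x = outside} {outside} {inside}  (sparse D) = ⊥-elim (1+2[1+w]≮3 _ (D 3 ≤-refl))

-- Condition (2) at i = 4 forces 2, 3, 4 ∉ S, so apart from the special pair, 2, 3, 4 ∈ T and the
-- rest is a walk from position 5 on, with k - 3 elements left for T and k - 1 for S.
data Shape (m k c : ℕ) : Subset (4 + m) → Subset (4 + m) → Set where
  special : Shape m k c (inside ∷ outside ∷ outside ∷ inside ∷ ∅) (outside ∷ inside ∷ inside ∷ inside ∷ ∅)
  general : ∀ {t s} → Walk c k (2 + k) m t s →
            Shape m k c (inside ∷ outside ∷ outside ∷ outside ∷ s) (outside ∷ inside ∷ inside ∷ inside ∷ t)

resistant-shape : ∀ m k c (S T : Subset (4 + m)) → T ⊆ interval 2 (4 + m) → m ≡ k + (2 + k) + c →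
                  Resistant (4 + m) (3 + k) S T → Shape m k c S T
resistant-shape m k c _ _ _ _ (inj₁ (refl , refl)) =
  subst₂ (Shape m k c) (cong (λ v → inside ∷ outside ∷ outside ∷ inside ∷ v) ∅≡)
                       (cong (λ v → outside ∷ inside ∷ inside ∷ inside ∷ v) ∅≡)
         special
  where
  ∅≡ : ∅ ≡ tabulate (λ _ → outside)
  ∅≡ = sym (tabulate-const m outside)
resistant-shape m k c S (inside ∷ t) T⊆ _ (inj₂ _) with T⊆ here
... | ()
resistant-shape m k c (outside ∷ s) (outside ∷ t) _ _ (inj₂ (_ , _ , (_ , () , _) , _))
resistant-shape m k c (inside ∷ s) (outside ∷ t) _ _ (inj₂ (fzero , _ , (() , _) , _))
resistant-shape m k c (inside ∷ x ∷ y ∷ z ∷ s) (outside ∷ t) _ m≡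
                (inj₂ (fsuc j , _ , (∩≡ , ∪≡ , ∣S∣≤ , ∣T∣≤) , dense))
  with sparse-prefix (sparse-start (x ∷ y ∷ z ∷ s) dense)
     | split (x ∷ y ∷ z ∷ s) t j (∷-injectiveʳ ∩≡) (∷-injectiveʳ ∪≡)
... | refl , refl , refl | toT (toT (toT sp)) =
  general (split⇒walk sp m≡ (trans (+-comm k 3) (sym (+-identityʳ (3 + k)))) ≤-refl
                          (s≤s⁻¹ (s≤s⁻¹ (s≤s⁻¹ ∣T∣≤))) (s≤s⁻¹ ∣S∣≤)
                          (sparse-outside (sparse-outside (sparse-outside (sparse-start _ dense)))))

≺-drop-prefix : ∀ {n} {A B : Subset n} →
        (outside ∷ inside ∷ inside ∷ inside ∷ A) ≺ (outside ∷ inside ∷ inside ∷ inside ∷ B) → A ≺ B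
≺-drop-prefix = ≺-∷⁻ inside ∘ ≺-∷⁻ inside ∘ ≺-∷⁻ inside ∘ ≺-∷⁻ outside

-- The (k-1)-subsets of [2,n] meeting {2,3,4}; all of them precede S when 2, 3, 4 ∉ S.
front : ℕ → ℕ → ℕ
front m k = (m C suc k + suc m C suc k) + suc (suc m) C suc k

ℒ-sum-general : ∀ m k (t s : Subset m) →
  #≺ (2 + k) (outside ∷ outside ∷ outside ∷ s) + #≺ (3 + k) (inside ∷ inside ∷ inside ∷ t)
    ≡ (#≺ k t + #≺ (2 + k) s) + front m k
ℒ-sum-general m k t s = rearrange (#≺ (2 + k) s) (m C suc k) (suc m C suc k) (suc (suc m) C suc k) (#≺ k t)
  where
  rearrange : ∀ x p q r y → (((x + p) + q) + r) + y ≡ (y + x) + ((p + q) + r)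
  rearrange = solve-∀

ℒ-sum-special : ∀ m k →
  #≺ (2 + k) (outside ∷ outside ∷ inside ∷ ∅ {m}) + #≺ (3 + k) (inside ∷ inside ∷ inside ∷ ∅ {m})
    ≡ m C k + front m k
ℒ-sum-special m k rewrite #≺-∅ m (suc k) | #≺-∅ m k = +-comm (front m k) (m C k)

shape-compare : ∀ {m k d S T S′ T′} → Shape m k (suc d) S T → Shape m k (suc d) S′ T′ → T′ ≺ T → T′ ≢ T →
  (#≺ (3 + k) (tail T′) < #≺ (3 + k) (tail T))
  × (#≺ (2 + k) (tail S) + #≺ (3 + k) (tail T) < #≺ (2 + k) (tail S′) + #≺ (3 + k) (tail T′))
shape-compare special special _ T′≢T = ⊥-elim (T′≢T refl)
shape-compare (general w) special T′≺T _ = ⊥-elim (∅⊀ (walk-nonempty w) (≺-drop-prefix T′≺T))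
shape-compare {m} {k} special (general {t′} {s′} w′) _ _ =
  subst (#≺ k t′ <_) (sym (#≺-∅ m k)) (proj₂ (#≺-walk-t w′)) ,
  subst₂ _<_ (sym (ℒ-sum-special m k)) (sym (ℒ-sum-general m k t′ s′))
    (+-monoˡ-< (front m k) (proj₁ (#≺-walk-sum w′)))
shape-compare {m} {k} (general {t} {s} w) (general {t′} {s′} w′) T′≺T T′≢T =
  let (fewer , more) = #≺-walk-compare w w′ (≺-drop-prefix T′≺T)
                         (T′≢T ∘ cong (λ v → outside ∷ inside ∷ inside ∷ inside ∷ v)) in
  fewer ,
  subst₂ _<_ (sym (ℒ-sum-general m k t s)) (sym (ℒ-sum-general m k t′ s′)) (+-monoˡ-< (front m k) more)

n>2k⇒excess : ∀ m k → 2 * (3 + k) < 4 + m → ∃ λ d → m ≡ k + (2 + k) + suc d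
n>2k⇒excess m k 2k<n =
  let (o , eq) = m≤n⇒∃[o]m+o≡n 2k<n in
  o , +-cancelˡ-≡ 4 m _ (trans (sym eq) (reshape k o))
  where
  reshape : ∀ k o → suc (2 * (3 + k)) + o ≡ 4 + (k + (2 + k) + suc o)
  reshape = solve-∀

lemma23 : (n k : ℕ) → 2 * k < n → 6 ≤ 2 * k
    → (S T S′ T′ : Subset n)
    → T ⊆ interval 2 n → T′ ⊆ interval 2 n
    → Resistant n k S T → Resistant n k S′ T′
    → T′ ≺ T → T′ ≢ T
    → (∣ℒ∣ T′ k < ∣ℒ∣ T k)
      × (∣ℒ∣ S (k ∸ 1) + ∣ℒ∣ T k < ∣ℒ∣ S′ (k ∸ 1) + ∣ℒ∣ T′ k)
lemma23 (suc (suc (suc (suc m)))) (suc (suc (suc k))) 2k<n _ S T S′ T′ T⊆ T′⊆ rST rS′T′ T′≺T T′≢T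
  rewrite ∣ℒ∣≡#≺-tail T (3 + k) | ∣ℒ∣≡#≺-tail T′ (3 + k) | ∣ℒ∣≡#≺-tail S (2 + k) | ∣ℒ∣≡#≺-tail S′ (2 + k) =
  let (d , m≡) = n>2k⇒excess m k 2k<n in
  shape-compare (resistant-shape m k (suc d) S T T⊆ m≡ rST) (resistant-shape m k (suc d) S′ T′ T′⊆ m≡ rS′T′)
                T′≺T T′≢T
lemma23 _ 0 _ ()
lemma23 _ 1 _ (s≤s (s≤s ()))
lemma23 _ 2 _ (s≤s (s≤s (s≤s (s≤s ()))))
lemma23 0 (suc (suc (suc _))) () _
lemma23 1 (suc (suc (suc _))) (s≤s ()) _
lemma23 2 (suc (suc (suc _))) (s≤s (s≤s ())) _
lemma23 3 (suc (suc (suc _))) (s≤s (s≤s (s≤s ()))) _
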